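{- Let $n\ge3$ and let $\bar t_n$ be the number of isomorphism classes of $3$-nilpotent semigroups of order $n$. Then $$\bar t_n\ \ge\ \sum_{r=1}^{n-2}\frac{1}{r!}\left\{ {r^{2}+1 \atop n-r} \right\}=\frac{t_n}{n!},$$ where $t_n$ is the number of binary operations on a fixed $n$-element set making it a $3$-nilpotent semigroup.
   Context: A semigroup is $3$-nilpotent if it is finite, has a zero $0$, satisfies $xyz=0$ for all $x,y,z$, and has some $ab\ne0$. $\left\{ {a \atop b} \right\}$ is the Stirling number of the second kind ($0$ if $b>a$). -}

module Defs where

open import Data.Nat using (ℕ; zero; suc; _+_; _*_; _∸_; _!)
open import Data.Nat.Properties using (_!≢0)
open import Data.Fin using (Fin)
open import Data.Vec using (Vec; lookup)
open import Data.Product using (Σ; ∃; ∃-syntax; _×_)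
open import Data.List using (List; applyUpTo; foldr)
open import Data.Integer using (+_)
open import Data.Rational using (ℚ; 0ℚ; _/_) renaming (_+_ to _+ℚ_)
open import Data.Fin.Permutation using (Permutation′; _⟨$⟩ʳ_)
open import Relation.Binary.PropositionalEquality using (_≡_; _≢_)

-- A binary operation on the fixed n-element set Fin n, stored as its
-- (finite) multiplication table, so that equality of operations is ≡.
Table : ℕ → Set
Table n = Vec (Vec (Fin n) n) n

mul : ∀ {n} → Table n → Fin n → Fin n → Fin n
mul T a b = lookup (lookup T a) b

IsNil3 : ∀ {n} → Table n → Set
IsNil3 {n} T =
  Σ (Fin n) λ z →
    (∀ x → mul T z x ≡ z × mul T x z ≡ z)
  × (∀ x y w → mul T (mul T x y) w ≡ mul T x (mul T y w))
  × (∀ x y w → mul T (mul T x y) w ≡ z)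
  × (∃[ a ] ∃[ b ] mul T a b ≢ z)

Iso : ∀ {n} → Table n → Table n → Set
Iso {n} A B = Σ (Permutation′ n) λ π →
  ∀ a b → π ⟨$⟩ʳ mul A a b ≡ mul B (π ⟨$⟩ʳ a) (π ⟨$⟩ʳ b)

S₂ : ℕ → ℕ → ℕ
S₂ zero zero = 1
S₂ zero (suc k) = 0
S₂ (suc m) zero = 0
S₂ (suc m) (suc k) = suc k * S₂ m (suc k) + S₂ m k

term : ℕ → ℕ → ℚ
term n r = _/_ (+ S₂ (r * r + 1) (n ∸ r)) (r !) {{r !≢0}}

stirlingSum : ℕ → ℚ
stirlingSum n = foldr _+ℚ_ 0ℚ (applyUpTo (λ i → term n (suc i)) (n ∸ 2))

-- A 3-nilpotent operation on Fin n is determined by its set A of non-products, by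
-- its zero and by the products of members of A: these r² + 1 values lie outside A
-- and, as every product is one of them, they cover the s = n - r elements outside A.
-- Conversely any such covering assignment defines a 3-nilpotent operation unless
-- s = 1, when all products would equal the zero.  Hence the operations with
-- non-product set A are counted by the s! S(r² + 1, s) surjections, and summing over
-- A gives t_n = Σ_{r=1}^{n-2} C(n, r) (n - r)! S(r² + 1, n - r), i.e. n! times the
-- Stirling sum.  Finally an operation is determined by its isomorphism class and a
-- permutation, so t_n ≤ n! t̄_n.

module Submission where

open import Defs
open import Data.Nat using (ℕ; zero; suc; _+_; _*_; _∸_; _!; _≤_; _<_; s≤s; z≤n; NonZero)
open import Data.Nat.Properties
  using (_!≢0; ≤-antisym; ≤-trans; ≤-reflexive; +-assoc; +-comm; +-suc; +-identityʳ; *-identityʳ; *-zeroʳ;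
         n∸n≡0; m+n∸n≡m; +-∸-assoc; m+[n∸m]≡n; m≤n⇒m≤1+n)
open import Data.Nat.ListAction using (sum)
open import Data.Nat.ListAction.Properties using (sum-++)
open import Data.Nat.Tactic.RingSolver using (solve-∀)
open import Data.Integer using (+_)
import Data.Integer as ℤ
open import Data.Integer.Properties using (pos-*)
open import Data.Rational using (ℚ; 0ℚ; _/_; toℚᵘ) renaming (_+_ to _+ℚ_; _≤_ to _≤ℚ_)
open import Data.Rational.Properties using (toℚᵘ-injective; toℚᵘ-fromℚᵘ; toℚᵘ-homo-+; toℚᵘ-cancel-≤)
open import Data.Rational.Unnormalised as ℚᵘ using (mkℚᵘ; _≃_; *≡*; *≤*)
open import Data.Rational.Unnormalised.Properties using (≃-trans; ≃-sym; +-cong; ≤-respˡ-≃; ≤-respʳ-≃)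
open import Data.Bool using (not)
open import Data.Bool.Properties using (¬-not) renaming (_≟_ to _≟ᵇ_)
open import Data.Fin using (Fin; zero; suc; _↑ˡ_; _↑ʳ_; splitAt; join; combine; remQuot; punchIn; punchOut)
open import Data.Fin.Properties
  using (injective⇒≤; ↑ˡ-injective; ↑ʳ-injective; splitAt-↑ˡ; splitAt-↑ʳ; join-splitAt; combine-injective;
         combine-remQuot; remQuot-combine; punchIn-punchOut; punchOut-punchIn; punchInᵢ≢i; punchOut-cong;
         punchIn-injective; any?; _≟_; ¬Fin0)
open import Data.Fin.Permutation
  using (Permutation′; _⟨$⟩ʳ_; _⟨$⟩ˡ_; _≈_; remove; insert; insert-remove; insert-punchIn; inverseˡ)
open import Data.Fin.Subset using (Subset; inside; outside; ∁; ∣_∣)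
open import Data.Maybe using (Maybe; just; nothing)
import Data.Maybe as Maybe
open import Data.Maybe.Properties using (just-injective)
open import Data.Vec using (Vec; []; _∷_; lookup; tabulate; map; head; tail)
open import Data.Vec.Properties using (∷-injective; lookup∘tabulate; lookup-map; tabulate∘lookup; tabulate-cong)
open import Data.List using (List; length; foldr; applyUpTo; _++_; [_])
import Data.List as List
open import Data.List.Properties using (applyUpTo-∷ʳ)
open import Data.List.Membership.Propositional using (_∈_)
open import Data.List.Membership.Propositional.Properties using (∈-lookup)
open import Data.List.Relation.Unary.All as All using (All)
open import Data.List.Relation.Unary.Any using (Any; index)
open import Data.List.Relation.Unary.Any.Properties using (lookup-index)
open import Data.List.Relation.Unary.AllPairs using (AllPairs; _∷_)
open import Data.List.Relation.Unary.Unique.Propositional using (Unique)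
open import Data.Product using (∃-syntax; _×_; _,_; proj₁; proj₂)
open import Data.Sum using (_⊎_; inj₁; inj₂; [_,_]′)
open import Data.Empty using (⊥; ⊥-elim)
open import Function using (_∘_)
open import Function.Bundles using (_⇔_; Equivalence)
open import Relation.Nullary using (¬_; Dec; yes; no; does)
open import Relation.Binary.PropositionalEquality
  using (_≡_; _≢_; refl; sym; trans; cong; cong₂; subst; subst₂; module ≡-Reasoning)
open ≡-Reasoning

-- {x ∣ P x} has exactly k elements.  P may be proof-relevant, so injectivity
-- is only asked of the underlying elements.
record Card {X : Set} (P : X → Set) (k : ℕ) : Set where
  field
    to       : ∀ x → P x → Fin k
    to-inj   : ∀ {x y} (p : P x) (q : P y) → to x p ≡ to y q → x ≡ y
    from     : Fin k → X
    from-P   : ∀ i → P (from i)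
    from-inj : ∀ {i j} → from i ≡ from j → i ≡ j

Unique⇒lookup-injective : ∀ {X : Set} {xs : List X} → Unique xs →
                          ∀ i j → List.lookup xs i ≡ List.lookup xs j → i ≡ j
Unique⇒lookup-injective (_ ∷ _)  zero    zero    _  = refl
Unique⇒lookup-injective (x∉ ∷ _) zero    (suc j) eq = ⊥-elim (All.lookup x∉ (∈-lookup j) eq)
Unique⇒lookup-injective (x∉ ∷ _) (suc i) zero    eq = ⊥-elim (All.lookup x∉ (∈-lookup i) (sym eq))
Unique⇒lookup-injective (_ ∷ u)  (suc i) (suc j) eq = cong suc (Unique⇒lookup-injective u i j eq)

length≤ : ∀ {X : Set} {k} (xs : List X) → Unique xs → (f : ∀ x → x ∈ xs → Fin k) →
          (∀ {x y} p q → f x p ≡ f y q → x ≡ y) → length xs ≤ k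
length≤ xs u f f-inj = injective⇒≤ λ {i} {j} eq →
  Unique⇒lookup-injective u i j (f-inj (∈-lookup i) (∈-lookup j) eq)

≤length : ∀ {X : Set} {k} (xs : List X) (f : Fin k → X) → (∀ i → f i ∈ xs) →
          (∀ {i j} → f i ≡ f j → i ≡ j) → k ≤ length xs
≤length xs f f∈ f-inj = injective⇒≤ {f = λ i → index (f∈ i)} λ {i} {j} eq →
  f-inj (trans (lookup-index (f∈ i)) (trans (cong (List.lookup xs) eq) (sym (lookup-index (f∈ j)))))

Card⇒length≡ : ∀ {X : Set} {P : X → Set} {k} → Card P k → (xs : List X) → Unique xs →
               (∀ x → P x ⇔ x ∈ xs) → length xs ≡ k
Card⇒length≡ c xs u P⇔∈ = ≤-antisym
  (length≤ xs u (λ x x∈ → to x (Equivalence.from (P⇔∈ x) x∈)) (λ _ _ → to-inj _ _))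
  (≤length xs from (λ i → Equivalence.to (P⇔∈ (from i)) (from-P i)) from-inj)
  where open Card c

Card-empty : ∀ {X : Set} {P : X → Set} → (∀ x → P x → ⊥) → Card P 0
Card-empty ¬P = record
  { to = λ x p → ⊥-elim (¬P x p) ; to-inj = λ p → ⊥-elim (¬P _ p)
  ; from = λ () ; from-P = λ () ; from-inj = λ { {()} } }

Card-transport : ∀ {X Y : Set} {P : X → Set} {Q : Y → Set} {k} → Card Q k →
  (φ : ∀ x → P x → Y) → (∀ x p → Q (φ x p)) → (∀ {x y} p q → φ x p ≡ φ y q → x ≡ y) →
  (ψ : Y → X) → (∀ y → Q y → P (ψ y)) → (∀ {y y′} → Q y → Q y′ → ψ y ≡ ψ y′ → y ≡ y′) →
  Card P k
Card-transport c φ φ-Q φ-inj ψ ψ-P ψ-inj = record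
  { to       = λ x p → to (φ x p) (φ-Q x p)
  ; to-inj   = λ p q eq → φ-inj p q (to-inj _ _ eq)
  ; from     = λ i → ψ (from i)
  ; from-P   = λ i → ψ-P _ (from-P i)
  ; from-inj = λ eq → from-inj (ψ-inj (from-P _) (from-P _) eq) }
  where open Card c

Card-resp : ∀ {X : Set} {P Q : X → Set} {k} → Card P k →
            (∀ {x} → P x → Q x) → (∀ {x} → Q x → P x) → Card Q k
Card-resp c P⇒Q Q⇒P = record
  { to = λ x q → to x (Q⇒P q) ; to-inj = λ p q → to-inj _ _
  ; from = from ; from-P = λ i → P⇒Q (from-P i) ; from-inj = from-inj }
  where open Card c

↑ˡ≢↑ʳ : ∀ {a b} (i : Fin a) (j : Fin b) → i ↑ˡ b ≢ a ↑ʳ j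
↑ˡ≢↑ʳ {a} {b} i j eq with trans (sym (splitAt-↑ˡ a i b)) (trans (cong (splitAt a) eq) (splitAt-↑ʳ a b j))
... | ()

module _ {X : Set} {P D : X → Set} (D? : ∀ x → Dec (D x)) {a b : ℕ}
         (yesCard : Card (λ x → P x × D x) a) (noCard : Card (λ x → P x × ¬ D x) b) where
  private
    module Y = Card yesCard
    module N = Card noCard

    toDec : ∀ x → P x → Dec (D x) → Fin (a + b)
    toDec x p (yes d) = Y.to x (p , d) ↑ˡ b
    toDec x p (no ¬d) = a ↑ʳ N.to x (p , ¬d)

    toDec-inj : ∀ {x y} p q d e → toDec x p d ≡ toDec y q e → x ≡ y
    toDec-inj p q (yes d) (yes e) eq = Y.to-inj _ _ (↑ˡ-injective b _ _ eq)
    toDec-inj p q (yes d) (no ¬e) eq = ⊥-elim (↑ˡ≢↑ʳ _ _ eq)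
    toDec-inj p q (no ¬d) (yes e) eq = ⊥-elim (↑ˡ≢↑ʳ _ _ (sym eq))
    toDec-inj p q (no ¬d) (no ¬e) eq = N.to-inj _ _ (↑ʳ-injective a _ _ eq)

    fromSplit : Fin a ⊎ Fin b → X
    fromSplit = [ Y.from , N.from ]′

    fromSplit-P : ∀ s → P (fromSplit s)
    fromSplit-P (inj₁ i) = proj₁ (Y.from-P i)
    fromSplit-P (inj₂ j) = proj₁ (N.from-P j)

    fromSplit-inj : ∀ s t → fromSplit s ≡ fromSplit t → s ≡ t
    fromSplit-inj (inj₁ i) (inj₁ j) eq = cong inj₁ (Y.from-inj eq)
    fromSplit-inj (inj₁ i) (inj₂ j) eq = ⊥-elim (proj₂ (N.from-P j) (subst D eq (proj₂ (Y.from-P i))))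
    fromSplit-inj (inj₂ i) (inj₁ j) eq = ⊥-elim (proj₂ (N.from-P i) (subst D (sym eq) (proj₂ (Y.from-P j))))
    fromSplit-inj (inj₂ i) (inj₂ j) eq = cong inj₂ (N.from-inj eq)

  Card-split : Card P (a + b)
  Card-split = record
    { to       = λ x p → toDec x p (D? x)
    ; to-inj   = λ {x} {y} p q → toDec-inj p q (D? x) (D? y)
    ; from     = λ i → fromSplit (splitAt a i)
    ; from-P   = λ i → fromSplit-P (splitAt a i)
    ; from-inj = λ {i} {j} eq → trans (sym (join-splitAt a b i))
        (trans (cong (join a b) (fromSplit-inj (splitAt a i) (splitAt a j) eq)) (join-splitAt a b j)) }

Card-Fin× : ∀ {Y : Set} {Q : Y → Set} {a b} → Card Q b → Card (λ (p : Fin a × Y) → Q (proj₂ p)) (a * b)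
Card-Fin× {a = a} {b} c = record
  { to       = λ { (x , y) q → combine x (to y q) }
  ; to-inj   = λ { {x , y} {x′ , y′} p q eq → cong₂ _,_ (proj₁ (combine-injective x _ x′ _ eq))
                                                      (to-inj p q (proj₂ (combine-injective x _ x′ _ eq))) }
  ; from     = λ i → proj₁ (remQuot {a} b i) , from (proj₂ (remQuot {a} b i))
  ; from-P   = λ i → from-P (proj₂ (remQuot {a} b i))
  ; from-inj = λ {i} {j} eq → trans (sym (combine-remQuot {a} b i))
      (trans (cong₂ combine (cong proj₁ eq) (from-inj (cong proj₂ eq))) (combine-remQuot {a} b j)) }
  where open Card c

subsetSum : ∀ N → (Subset N → ℕ) → ℕ
subsetSum zero    F = F []
subsetSum (suc N) F = subsetSum N (F ∘ (outside ∷_)) + subsetSum N (F ∘ (inside ∷_))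

∷-≡ : ∀ {A : Set} {N} {v : Vec A (suc N)} {x xs} → head v ≡ x → tail v ≡ xs → v ≡ x ∷ xs
∷-≡ {v = _ ∷ _} refl refl = refl

outside≢inside : outside ≢ inside
outside≢inside ()

Card-partition : ∀ {X : Set} {P : X → Set} N (class : X → Subset N) (F : Subset N → ℕ) →
  (∀ A → Card (λ x → P x × class x ≡ A) (F A)) → Card P (subsetSum N F)
Card-partition zero class F c = Card-resp (c []) proj₁ (λ p → p , emptyVec (class _))
  where
  emptyVec : (v : Subset 0) → v ≡ []
  emptyVec [] = refl
Card-partition (suc N) class F c = Card-split (λ x → head (class x) ≟ᵇ outside)
  (Card-partition N (tail ∘ class) (F ∘ (outside ∷_)) λ A → Card-resp (c (outside ∷ A))
    (λ (p , eq) → (p , cong head eq) , cong tail eq)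
    (λ ((p , h) , t) → p , ∷-≡ h t))
  (Card-partition N (tail ∘ class) (F ∘ (inside ∷_)) λ A → Card-resp (c (inside ∷ A))
    (λ (p , eq) → (p , λ h → outside≢inside (trans (sym h) (cong head eq))) , cong tail eq)
    (λ ((p , h) , t) → p , ∷-≡ (¬-not h) t))

vec-ext : ∀ {A : Set} {n} {xs ys : Vec A n} → (∀ i → lookup xs i ≡ lookup ys i) → xs ≡ ys
vec-ext {xs = xs} {ys} eq = trans (sym (tabulate∘lookup xs)) (trans (tabulate-cong eq) (tabulate∘lookup ys))

Occurs : ∀ {A : Set} {m} → A → Vec A m → Set
Occurs x w = ∃[ i ] lookup w i ≡ x

Onto : ∀ {m k} → Vec (Fin k) m → Set
Onto w = ∀ c → Occurs c w

surjCount : ℕ → ℕ → ℕ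
surjCount zero    zero    = 1
surjCount zero    (suc k) = 0
surjCount (suc m) zero    = 0
surjCount (suc m) (suc k) = suc k * surjCount m (suc k) + suc k * surjCount m k

squeeze : ∀ {m k} (x : Fin (suc k)) (w : Vec (Fin (suc k)) m) → ¬ Occurs x w → Vec (Fin k) m
squeeze x w x∉w = tabulate λ i → punchOut λ eq → x∉w (i , sym eq)

map-punchIn-squeeze : ∀ {m k} x (w : Vec (Fin (suc k)) m) x∉w → map (punchIn x) (squeeze x w x∉w) ≡ w
map-punchIn-squeeze x w x∉w = vec-ext λ i → trans (lookup-map i (punchIn x) (squeeze x w x∉w))
  (trans (cong (punchIn x) (lookup∘tabulate _ i)) (punchIn-punchOut _))

map-punchIn-injective : ∀ {m k} (x : Fin (suc k)) {u u′ : Vec (Fin k) m} →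
                        map (punchIn x) u ≡ map (punchIn x) u′ → u ≡ u′
map-punchIn-injective x {u} {u′} eq = vec-ext λ i → punchIn-injective x _ _
  (trans (sym (lookup-map i (punchIn x) u)) (trans (cong (λ v → lookup v i) eq) (lookup-map i (punchIn x) u′)))

Onto-tail : ∀ {m k} {x : Fin k} {w : Vec (Fin k) m} → Onto (x ∷ w) → Occurs x w → Onto w
Onto-tail onto x∈w c with onto c
... | zero  , refl = x∈w
... | suc i , eq   = i , eq

Onto-∷ : ∀ {m k} (x : Fin k) {w : Vec (Fin k) m} → Onto w → Onto (x ∷ w)
Onto-∷ x onto c = suc (proj₁ (onto c)) , proj₂ (onto c)

Onto-squeeze : ∀ {m k} {x : Fin (suc k)} {w : Vec (Fin (suc k)) m} →
               Onto (x ∷ w) → (x∉w : ¬ Occurs x w) → Onto (squeeze x w x∉w)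
Onto-squeeze {x = x} onto x∉w c with onto (punchIn x c)
... | zero  , eq = ⊥-elim (punchInᵢ≢i x c (sym eq))
... | suc i , eq = i , trans (lookup∘tabulate _ i) (trans (punchOut-cong x eq) (punchOut-punchIn x))

Onto-punchIn : ∀ {m k} (x : Fin (suc k)) {u : Vec (Fin k) m} → Onto u → Onto (x ∷ map (punchIn x) u)
Onto-punchIn x {u} onto c with x ≟ c
... | yes refl = zero , refl
... | no x≢c   = suc i , trans (lookup-map i (punchIn x) u) (trans (cong (punchIn x) eq) (punchIn-punchOut x≢c))
  where
  i = proj₁ (onto (punchOut x≢c))
  eq = proj₂ (onto (punchOut x≢c))

punchIn-avoids : ∀ {m k} (x : Fin (suc k)) (u : Vec (Fin k) m) → ¬ Occurs x (map (punchIn x) u)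
punchIn-avoids x u (i , eq) = punchInᵢ≢i x (lookup u i) (trans (sym (lookup-map i (punchIn x) u)) eq)

occurs? : ∀ {m k} (x : Fin k) (w : Vec (Fin k) m) → Dec (Occurs x w)
occurs? x w = any? λ i → lookup w i ≟ x

ontoRecurring : ∀ {m k c} → Card (Onto {m} {k}) c →
                Card (λ (v : Vec (Fin k) (suc m)) → Onto v × Occurs (head v) (tail v)) (k * c)
ontoRecurring surj = Card-transport (Card-Fin× surj)
  (λ v _ → head v , tail v) (λ { (x ∷ w) (onto , x∈w) → Onto-tail onto x∈w })
  (λ { {_ ∷ _} {_ ∷ _} _ _ refl → refl })
  (λ (x , w) → x ∷ w) (λ (x , w) onto → Onto-∷ x onto , onto x)
  (λ _ _ eq → cong₂ _,_ (proj₁ (∷-injective eq)) (proj₂ (∷-injective eq)))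

ontoFresh : ∀ {m k c} → Card (Onto {m} {k}) c →
            Card (λ (v : Vec (Fin (suc k)) (suc m)) → Onto v × ¬ Occurs (head v) (tail v)) (suc k * c)
ontoFresh {m} {k} surj = Card-transport (Card-Fin× surj)
  (λ v (_ , x∉w) → head v , squeeze (head v) (tail v) x∉w)
  (λ { (x ∷ w) (onto , x∉w) → Onto-squeeze onto x∉w })
  (λ { {x ∷ w} {_ ∷ w′} (_ , x∉w) (_ , x∉w′) → squeezed-≡ {x∉w = x∉w} {x∉w′} })
  (λ (x , u) → x ∷ map (punchIn x) u) (λ (x , u) onto → Onto-punchIn x onto , punchIn-avoids x u)
  (λ _ _ → punchedIn-≡)
  where
  squeezed-≡ : ∀ {x x′ : Fin (suc k)} {w w′ : Vec (Fin (suc k)) m} {x∉w x∉w′} →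
    (x , squeeze x w x∉w) ≡ (x′ , squeeze x′ w′ x∉w′) → x ∷ w ≡ x′ ∷ w′
  squeezed-≡ {x} {x′} {w} {w′} {x∉w} {x∉w′} eq with cong proj₁ eq
  ... | refl = cong (x ∷_) (begin
    w                                   ≡⟨ sym (map-punchIn-squeeze x w x∉w) ⟩
    map (punchIn x) (squeeze x w x∉w)   ≡⟨ cong (map (punchIn x)) (cong proj₂ eq) ⟩
    map (punchIn x) (squeeze x w′ x∉w′) ≡⟨ map-punchIn-squeeze x w′ x∉w′ ⟩
    w′                                  ∎)

  punchedIn-≡ : ∀ {x x′ : Fin (suc k)} {u u′ : Vec (Fin k) m} →
    x ∷ map (punchIn x) u ≡ x′ ∷ map (punchIn x′) u′ → (x , u) ≡ (x′ , u′)
  punchedIn-≡ eq with ∷-injective eq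
  ... | refl , tails = cong (_ ,_) (map-punchIn-injective _ tails)

surjections : ∀ m k → Card (Onto {m} {k}) (surjCount m k)
surjections zero zero = record
  { to = λ _ _ → zero ; to-inj = λ { {[]} {[]} _ _ _ → refl }
  ; from = λ _ → [] ; from-P = λ _ () ; from-inj = λ { {zero} {zero} _ → refl } }
surjections zero    (suc k) = Card-empty λ { [] onto → ¬Fin0 (proj₁ (onto zero)) }
surjections (suc m) zero    = Card-empty λ { (() ∷ _) }
surjections (suc m) (suc k) = Card-split (λ v → occurs? (head v) (tail v))
  (ontoRecurring (surjections m (suc k))) (ontoFresh (surjections m k))

elem : ∀ {n} (A : Subset n) → Fin ∣ A ∣ → Fin n
elem (inside  ∷ A) zero    = zero
elem (inside  ∷ A) (suc i) = suc (elem A i)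
elem (outside ∷ A) i       = suc (elem A i)

find : ∀ {n} (A : Subset n) → Fin n → Maybe (Fin ∣ A ∣)
find (inside  ∷ A) zero    = just zero
find (outside ∷ A) zero    = nothing
find (inside  ∷ A) (suc x) = Maybe.map suc (find A x)
find (outside ∷ A) (suc x) = find A x

elem-inside : ∀ {n} (A : Subset n) i → lookup A (elem A i) ≡ inside
elem-inside (inside  ∷ A) zero    = refl
elem-inside (inside  ∷ A) (suc i) = elem-inside A i
elem-inside (outside ∷ A) i       = elem-inside A i

find-elem : ∀ {n} (A : Subset n) i → find A (elem A i) ≡ just i
find-elem (inside  ∷ A) zero    = refl
find-elem (inside  ∷ A) (suc i) = cong (Maybe.map suc) (find-elem A i)
find-elem (outside ∷ A) i       = find-elem A i

find-just : ∀ {n} (A : Subset n) {x i} → find A x ≡ just i → elem A i ≡ x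
find-just (inside  ∷ A) {zero}  refl = refl
find-just (inside  ∷ A) {suc x} eq with find A x in fx
find-just (inside  ∷ A) {suc x} refl | just j = cong suc (find-just A fx)
find-just (outside ∷ A) {suc x} eq = cong suc (find-just A eq)

find-nothing : ∀ {n} (A : Subset n) {x} → find A x ≡ nothing → lookup A x ≡ outside
find-nothing (inside  ∷ A) {suc x} eq with find A x in fx
find-nothing (inside  ∷ A) {suc x} refl | nothing = find-nothing A fx
find-nothing (outside ∷ A) {zero}  eq = refl
find-nothing (outside ∷ A) {suc x} eq = find-nothing A eq

find-outside : ∀ {n} (A : Subset n) {x} → lookup A x ≡ outside → find A x ≡ nothing
find-outside (inside  ∷ A) {suc x} eq = cong (Maybe.map suc) (find-outside A eq)
find-outside (outside ∷ A) {zero}  eq = refl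
find-outside (outside ∷ A) {suc x} eq = find-outside A eq

find-inside : ∀ {n} (A : Subset n) {x} → lookup A x ≡ inside → ∃[ i ] find A x ≡ just i
find-inside A {x} eq with find A x in fx
... | just i  = i , refl
... | nothing with () ← trans (sym eq) (find-nothing A fx)

elem-injective : ∀ {n} (A : Subset n) {i j} → elem A i ≡ elem A j → i ≡ j
elem-injective A {i} {j} eq = just-injective (trans (sym (find-elem A i)) (trans (cong (find A) eq) (find-elem A j)))

elemᶜ : ∀ {n} (A : Subset n) → Fin ∣ ∁ A ∣ → Fin n
elemᶜ A = elem (∁ A)

elemᶜ-outside : ∀ {n} (A : Subset n) c → lookup A (elemᶜ A c) ≡ outside
elemᶜ-outside A c with lookup A (elemᶜ A c) in eq
... | outside = refl
... | inside with () ← trans (sym (elem-inside (∁ A) c)) (trans (lookup-map (elemᶜ A c) not A) (cong not eq))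

outside⇒inside-∁ : ∀ {n} (A : Subset n) {x} → lookup A x ≡ outside → lookup (∁ A) x ≡ inside
outside⇒inside-∁ A {x} x∉A = trans (lookup-map x not A) (cong not x∉A)

rankᶜ : ∀ {n} (A : Subset n) {x} → lookup A x ≡ outside → Fin ∣ ∁ A ∣
rankᶜ A x∉A = proj₁ (find-inside (∁ A) (outside⇒inside-∁ A x∉A))

elemᶜ-rankᶜ : ∀ {n} (A : Subset n) {x} (x∉A : lookup A x ≡ outside) → elemᶜ A (rankᶜ A x∉A) ≡ x
elemᶜ-rankᶜ A x∉A = find-just (∁ A) (proj₂ (find-inside (∁ A) (outside⇒inside-∁ A x∉A)))

-- binomial r s = (r + s choose r)
binomial : ℕ → ℕ → ℕ
binomial zero    s       = 1
binomial (suc r) zero    = 1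
binomial (suc r) (suc s) = binomial r (suc s) + binomial (suc r) s

binomial-factorial : ∀ r s → binomial r s * (r ! * s !) ≡ (r + s) !
binomial-factorial zero    s       = trans (+-identityʳ _) (+-identityʳ (s !))
binomial-factorial (suc r) zero    =
  trans (trans (+-identityʳ _) (*-identityʳ (suc r !))) (cong _! (sym (+-identityʳ (suc r))))
binomial-factorial (suc r) (suc s) = begin
  (a + b) * ((suc r * x) * (suc s * y))
    ≡⟨ split a b x y r s ⟩
  suc r * (a * (x * (suc s * y))) + suc s * (b * ((suc r * x) * y))
    ≡⟨ cong₂ (λ u v → suc r * u + suc s * v) (binomial-factorial r (suc s)) (binomial-factorial (suc r) s) ⟩
  suc r * (r + suc s) ! + suc s * (suc r + s) !
    ≡⟨ cong (λ u → suc r * u ! + suc s * suc (r + s) !) (+-suc r s) ⟩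
  suc r * F + suc s * F
    ≡⟨ merge r s F ⟩
  suc (suc (r + s)) * F
    ≡⟨ cong (λ u → suc u !) (sym (+-suc r s)) ⟩
  (suc r + suc s) !
    ∎
  where
  a b x y F : ℕ
  a = binomial r (suc s)
  b = binomial (suc r) s
  x = r !
  y = s !
  F = suc (r + s) !
  split : ∀ a b x y r s → (a + b) * ((suc r * x) * (suc s * y)) ≡
          suc r * (a * (x * (suc s * y))) + suc s * (b * ((suc r * x) * y))
  split = solve-∀
  merge : ∀ r s F → suc r * F + suc s * F ≡ suc (suc (r + s)) * F
  merge = solve-∀

-- diagSum N G = Σ_{r + s = N} G r s
diagSum : ℕ → (ℕ → ℕ → ℕ) → ℕ
diagSum zero    G = G 0 0
diagSum (suc N) G = G 0 (suc N) + diagSum N (λ r s → G (suc r) s)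

diagSum-cong : ∀ N {G G′ : ℕ → ℕ → ℕ} → (∀ r s → G r s ≡ G′ r s) → diagSum N G ≡ diagSum N G′
diagSum-cong zero    G≡ = G≡ 0 0
diagSum-cong (suc N) G≡ = cong₂ _+_ (G≡ 0 (suc N)) (diagSum-cong N λ r s → G≡ (suc r) s)

diagSum-+ : ∀ N (G G′ : ℕ → ℕ → ℕ) → diagSum N (λ r s → G r s + G′ r s) ≡ diagSum N G + diagSum N G′
diagSum-+ zero    G G′ = refl
diagSum-+ (suc N) G G′ = trans (cong (λ u → G 0 (suc N) + G′ 0 (suc N) + u) (diagSum-+ N _ _))
                                (interchange (G 0 (suc N)) (G′ 0 (suc N)) _ _)
  where
  interchange : ∀ a b c d → (a + b) + (c + d) ≡ (a + c) + (b + d)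
  interchange = solve-∀

diagSum-last : ∀ N (G : ℕ → ℕ → ℕ) → diagSum (suc N) G ≡ diagSum N (λ r s → G r (suc s)) + G (suc N) 0
diagSum-last zero    G = refl
diagSum-last (suc N) G = trans (cong (λ u → G 0 (suc (suc N)) + u) (diagSum-last N (λ r s → G (suc r) s)))
                               (sym (+-assoc (G 0 (suc (suc N))) _ _))

diagSum-pascal : ∀ N (H : ℕ → ℕ → ℕ) →
  diagSum N (λ r s → binomial r s * H r (suc s)) + diagSum N (λ r s → binomial r s * H (suc r) s) ≡
  diagSum (suc N) (λ r s → binomial r s * H r s)
diagSum-pascal zero    H = refl
diagSum-pascal (suc N) H = begin
  h + X + Y
    ≡⟨ cong (λ u → h + X + u) (diagSum-last N (λ r s → binomial r s * H (suc r) s)) ⟩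
  h + X + (Y′ + corner)
    ≡⟨ regroup h X Y′ corner ⟩
  h + ((X + Y′) + corner)
    ≡⟨ cong (λ u → h + (u + corner)) (sym (diagSum-+ N X-term Y′-term)) ⟩
  h + (diagSum N (λ r s → X-term r s + Y′-term r s) + corner)
    ≡⟨ cong (λ u → h + (u + corner)) (diagSum-cong N pascal) ⟩
  h + (diagSum N (λ r s → Z r (suc s)) + Z (suc N) 0)
    ≡⟨ cong (λ u → h + u) (sym (diagSum-last N Z)) ⟩
  h + diagSum (suc N) Z
    ∎
  where
  h X Y Y′ corner : ℕ
  h = binomial 0 (suc (suc N)) * H 0 (suc (suc N))
  X-term Y′-term Z : ℕ → ℕ → ℕ
  X-term r s = binomial (suc r) s * H (suc r) (suc s)
  Y′-term r s = binomial r (suc s) * H (suc r) (suc s)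
  X = diagSum N X-term
  Y = diagSum (suc N) (λ r s → binomial r s * H (suc r) s)
  Y′ = diagSum N Y′-term
  corner = 1 * H (suc (suc N)) 0
  Z r s = binomial (suc r) s * H (suc r) s
  regroup : ∀ a x y c → a + x + (y + c) ≡ a + ((x + y) + c)
  regroup = solve-∀
  pascal : ∀ r s → X-term r s + Y′-term r s ≡ Z r (suc s)
  pascal r s = sym (*-distribʳ-+′ (H (suc r) (suc s)) (binomial r (suc s)) (binomial (suc r) s))
    where
    *-distribʳ-+′ : ∀ x a b → (a + b) * x ≡ b * x + a * x
    *-distribʳ-+′ = solve-∀

subsetSum-binomial : ∀ N (H : ℕ → ℕ → ℕ) →
  subsetSum N (λ A → H ∣ A ∣ ∣ ∁ A ∣) ≡ diagSum N (λ r s → binomial r s * H r s)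
subsetSum-binomial zero    H = sym (+-identityʳ (H 0 0))
subsetSum-binomial (suc N) H = trans
  (cong₂ _+_ (subsetSum-binomial N (λ r s → H r (suc s))) (subsetSum-binomial N (λ r s → H (suc r) s)))
  (diagSum-pascal N H)

≃-cross : ∀ a b d e → a * suc e ≡ b * suc d → mkℚᵘ (+ a) d ≃ mkℚᵘ (+ b) e
≃-cross a b d e eq = *≡* (trans (sym (pos-* a (suc e))) (trans (cong +_ eq) (pos-* b (suc d))))

toℚᵘ-/ : ∀ a d → toℚᵘ ((+ a) / suc d) ≃ mkℚᵘ (+ a) d
toℚᵘ-/ a d = toℚᵘ-fromℚᵘ (mkℚᵘ (+ a) d)

/-cross : ∀ a b d e .{{_ : NonZero d}} .{{_ : NonZero e}} → a * e ≡ b * d → (+ a) / d ≡ (+ b) / e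
/-cross a b (suc d) (suc e) eq =
  toℚᵘ-injective (≃-trans (toℚᵘ-/ a d) (≃-trans (≃-cross a b d e eq) (≃-sym (toℚᵘ-/ b e))))

/-+ : ∀ a b d .{{_ : NonZero d}} → (+ a) / d +ℚ (+ b) / d ≡ (+ (a + b)) / d
/-+ a b (suc d) = toℚᵘ-injective (≃-trans (toℚᵘ-homo-+ ((+ a) / suc d) ((+ b) / suc d))
  (≃-trans (+-cong (toℚᵘ-/ a d) (toℚᵘ-/ b d)) (≃-trans sum-≃ (≃-sym (toℚᵘ-/ (a + b) d)))))
  where
  shape : ∀ a b d → (a * suc d + b * suc d) * suc d ≡ (a + b) * (suc d * suc d)
  shape = solve-∀

  sum-≃ : mkℚᵘ (+ a) d ℚᵘ.+ mkℚᵘ (+ b) d ≃ mkℚᵘ (+ (a + b)) d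
  sum-≃ rewrite sym (pos-* a (suc d)) | sym (pos-* b (suc d)) =
    ≃-cross (a * suc d + b * suc d) (a + b) _ d (shape a b d)

/-≤ : ∀ a b d .{{_ : NonZero d}} → a ≤ b * d → (+ a) / d ≤ℚ (+ b) / 1
/-≤ a b (suc d) a≤bd = toℚᵘ-cancel-≤ (≤-respʳ-≃ (≃-sym (toℚᵘ-/ b 0)) (≤-respˡ-≃ (≃-sym (toℚᵘ-/ a d))
  (*≤* (subst₂ ℤ._≤_ (pos-* a 1) (pos-* b (suc d))
    (ℤ.+≤+ (≤-trans (≤-reflexive (*-identityʳ a)) a≤bd))))))

sum-/ : ∀ m (g : ℕ → ℚ) (f : ℕ → ℕ) d .{{_ : NonZero d}} → (∀ i → i < m → g i ≡ (+ f i) / d) →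
        foldr _+ℚ_ 0ℚ (applyUpTo g m) ≡ (+ sum (applyUpTo f m)) / d
sum-/ zero    g f d g≡ = /-cross 0 0 1 d refl
sum-/ (suc m) g f d g≡ = trans
  (cong₂ _+ℚ_ (g≡ 0 (s≤s z≤n))
               (sum-/ m (λ i → g (suc i)) (λ i → f (suc i)) d λ i i<m → g≡ (suc i) (s≤s i<m)))
  (/-+ (f 0) _ d)

table-ext : ∀ {n} {A B : Table n} → (∀ a b → mul A a b ≡ mul B a b) → A ≡ B
table-ext eq = vec-ext λ a → vec-ext (eq a)

permIndex : ∀ {n} → Permutation′ n → Fin (n !)
permIndex {zero}  π = zero
permIndex {suc n} π = combine (π ⟨$⟩ʳ zero) (permIndex (remove zero π))

permIndex-injective : ∀ {n} (π σ : Permutation′ n) → permIndex π ≡ permIndex σ → π ≈ σ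
permIndex-injective {suc n} π σ eq zero    = proj₁ (combine-injective (π ⟨$⟩ʳ zero) _ (σ ⟨$⟩ʳ zero) _ eq)
permIndex-injective {suc n} π σ eq (suc k) = begin
  π ⟨$⟩ʳ suc k
    ≡⟨ sym (insert-remove zero π (suc k)) ⟩
  insert zero (π ⟨$⟩ʳ zero) (remove zero π) ⟨$⟩ʳ suc k
    ≡⟨ insert-punchIn zero _ (remove zero π) k ⟩
  punchIn (π ⟨$⟩ʳ zero) (remove zero π ⟨$⟩ʳ k)
    ≡⟨ cong₂ punchIn (proj₁ halves) (permIndex-injective _ _ (proj₂ halves) k) ⟩
  punchIn (σ ⟨$⟩ʳ zero) (remove zero σ ⟨$⟩ʳ k)
    ≡⟨ sym (insert-punchIn zero _ (remove zero σ) k) ⟩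
  insert zero (σ ⟨$⟩ʳ zero) (remove zero σ) ⟨$⟩ʳ suc k
    ≡⟨ insert-remove zero σ (suc k) ⟩
  σ ⟨$⟩ʳ suc k
    ∎
  where
  halves : π ⟨$⟩ʳ zero ≡ σ ⟨$⟩ʳ zero × permIndex (remove zero π) ≡ permIndex (remove zero σ)
  halves = combine-injective (π ⟨$⟩ʳ zero) (permIndex (remove zero π))
                             (σ ⟨$⟩ʳ zero) (permIndex (remove zero σ)) eq

perm-injective : ∀ {n} (π : Permutation′ n) {a b} → π ⟨$⟩ʳ a ≡ π ⟨$⟩ʳ b → a ≡ b
perm-injective π eq = trans (sym (inverseˡ π)) (trans (cong (π ⟨$⟩ˡ_) eq) (inverseˡ π))

Iso-injective : ∀ {n} {T T′ B B′ : Table n} (i : Iso T B) (i′ : Iso T′ B′) → B ≡ B′ →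
                proj₁ i ≈ proj₁ i′ → T ≡ T′
Iso-injective {T = T} {T′} {B} (π , π-hom) (π′ , π′-hom) refl π≈π′ = table-ext λ a b →
  perm-injective π (begin
    π ⟨$⟩ʳ mul T a b                ≡⟨ π-hom a b ⟩
    mul B (π ⟨$⟩ʳ a) (π ⟨$⟩ʳ b)     ≡⟨ cong₂ (mul B) (π≈π′ a) (π≈π′ b) ⟩
    mul B (π′ ⟨$⟩ʳ a) (π′ ⟨$⟩ʳ b)   ≡⟨ sym (π′-hom a b) ⟩
    π′ ⟨$⟩ʳ mul T′ a b              ≡⟨ sym (π≈π′ (mul T′ a b)) ⟩
    π ⟨$⟩ʳ mul T′ a b               ∎)

-- A table isomorphic to some member of R is determined by which member it is
-- and by the permutation.
length≤classes*n! : ∀ {n} {P : Table n → Set} (L R : List (Table n)) → Unique L →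
  (∀ T → P T ⇔ T ∈ L) → (∀ T → P T → Any (Iso T) R) → length L ≤ length R * n !
length≤classes*n! {n} {P} L R uniq P⇔∈ classOf = length≤ L uniq code code-inj
  where
  isoTo : ∀ T → T ∈ L → Any (Iso T) R
  isoTo T T∈ = classOf T (Equivalence.from (P⇔∈ T) T∈)

  code : ∀ T → T ∈ L → Fin (length R * n !)
  code T T∈ = combine (index (isoTo T T∈)) (permIndex (proj₁ (lookup-index (isoTo T T∈))))

  code-inj : ∀ {T T′} p q → code T p ≡ code T′ q → T ≡ T′
  code-inj {T} {T′} p q eq = Iso-injective isoT isoT′ (cong (List.lookup R) (proj₁ halves))
    (permIndex-injective (proj₁ isoT) (proj₁ isoT′) (proj₂ halves))
    where
    isoT : Iso T (List.lookup R (index (isoTo T p)))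
    isoT = lookup-index (isoTo T p)
    isoT′ : Iso T′ (List.lookup R (index (isoTo T′ q)))
    isoT′ = lookup-index (isoTo T′ q)
    halves : index (isoTo T p) ≡ index (isoTo T′ q) × permIndex (proj₁ isoT) ≡ permIndex (proj₁ isoT′)
    halves = combine-injective (index (isoTo T p)) (permIndex (proj₁ isoT))
                               (index (isoTo T′ q)) (permIndex (proj₁ isoT′)) eq

IsProduct : ∀ {n} → Table n → Fin n → Set
IsProduct T y = ∃[ a ] ∃[ b ] mul T a b ≡ y

isProduct? : ∀ {n} (T : Table n) y → Dec (IsProduct T y)
isProduct? T y = any? λ a → any? λ b → mul T a b ≟ y

nonProducts : ∀ {n} → Table n → Subset n
nonProducts T = tabulate λ y → not (does (isProduct? T y))

nonProducts-product : ∀ {n} (T : Table n) {y} → IsProduct T y → lookup (nonProducts T) y ≡ outside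
nonProducts-product T {y} prod with isProduct? T y | lookup∘tabulate (λ y → not (does (isProduct? T y))) y
... | yes _   | eq = eq
... | no ¬prod | _ = ⊥-elim (¬prod prod)

nonProducts-nonProduct : ∀ {n} (T : Table n) {y} → ¬ IsProduct T y → lookup (nonProducts T) y ≡ inside
nonProducts-nonProduct T {y} ¬prod with isProduct? T y | lookup∘tabulate (λ y → not (does (isProduct? T y))) y
... | yes prod | _ = ⊥-elim (¬prod prod)
... | no _     | eq = eq

nonProducts-outside : ∀ {n} (T : Table n) {y} → lookup (nonProducts T) y ≡ outside → IsProduct T y
nonProducts-outside T {y} y∉ with isProduct? T y | lookup∘tabulate (λ y → not (does (isProduct? T y))) y
... | yes prod | _  = prod
... | no _     | eq with () ← trans (sym eq) y∉

module Nil3 {n} (T : Table n) (nil : IsNil3 T) where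
  z : Fin n
  z = proj₁ nil

  z∙ : ∀ x → mul T z x ≡ z
  z∙ x = proj₁ (proj₁ (proj₂ nil) x)

  assoc : ∀ x y w → mul T (mul T x y) w ≡ mul T x (mul T y w)
  assoc = proj₁ (proj₂ (proj₂ nil))

  xyw≡z : ∀ x y w → mul T (mul T x y) w ≡ z
  xyw≡z = proj₁ (proj₂ (proj₂ (proj₂ nil)))

  nontrivial : ∃[ a ] ∃[ b ] mul T a b ≢ z
  nontrivial = proj₂ (proj₂ (proj₂ (proj₂ nil)))

  product∙ : ∀ {x} → IsProduct T x → ∀ y → mul T x y ≡ z
  product∙ (a , b , refl) y = xyw≡z a b y

  ∙product : ∀ {x} → IsProduct T x → ∀ y → mul T y x ≡ z
  ∙product (a , b , refl) y = trans (sym (assoc y a b)) (xyw≡z y a b)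

  z-product : IsProduct T z
  z-product = z , z , z∙ z

Fin-other : ∀ {m} → m ≢ 1 → (a : Fin m) → ∃[ c ] c ≢ a
Fin-other {suc zero}    m≢1 a       = ⊥-elim (m≢1 refl)
Fin-other {suc (suc m)} _   zero    = suc zero , λ ()
Fin-other {suc (suc m)} _   (suc a) = zero , λ ()

Fin1-trivial : ∀ {m} → m ≡ 1 → (i j : Fin m) → i ≡ j
Fin1-trivial refl zero zero = refl

module Fibre {n} (A : Subset n) where
  r s M : ℕ
  r = ∣ A ∣
  s = ∣ ∁ A ∣
  M = suc (r * r)

  InFibre : Table n → Set
  InFibre T = IsNil3 T × nonProducts T ≡ A

  cellOf : Maybe (Fin r) → Maybe (Fin r) → Fin M
  cellOf (just i) (just j) = suc (combine i j)
  cellOf _        _        = zero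

  -- the entry of the code that determines x ∙ y; entry zero holds the zero
  cell : Fin n → Fin n → Fin M
  cell x y = cellOf (find A x) (find A y)

  cell-elem : ∀ i j → cell (elem A i) (elem A j) ≡ suc (combine i j)
  cell-elem i j rewrite find-elem A i | find-elem A j = refl

  cell-outsideˡ : ∀ {x} y → lookup A x ≡ outside → cell x y ≡ zero
  cell-outsideˡ y x∉A rewrite find-outside A x∉A = refl

  cell-outsideʳ : ∀ x {y} → lookup A y ≡ outside → cell x y ≡ zero
  cell-outsideʳ x y∉A with find A x
  ... | just _  rewrite find-outside A y∉A = refl
  ... | nothing = refl

  cell-surjective : ∀ {w} → lookup A w ≡ outside → ∀ i → ∃[ x ] ∃[ y ] cell x y ≡ i
  cell-surjective {w} w∉A zero    = w , w , cell-outsideˡ w w∉A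
  cell-surjective     _   (suc c) = elem A i , elem A j , trans (cell-elem i j) (cong suc (combine-remQuot {r} r c))
    where
    i j : Fin r
    i = proj₁ (remQuot {r} r c)
    j = proj₂ (remQuot {r} r c)

  decode : Vec (Fin s) M → Table n
  decode h = tabulate λ x → tabulate λ y → elemᶜ A (lookup h (cell x y))

  mul-decode : ∀ h x y → mul (decode h) x y ≡ elemᶜ A (lookup h (cell x y))
  mul-decode h x y = trans (cong (λ row → lookup row y) (lookup∘tabulate _ x)) (lookup∘tabulate _ y)

  module Encode (T : Table n) (T∈ : InFibre T) where
    open Nil3 T (proj₁ T∈)

    product-outside : ∀ {y} → IsProduct T y → lookup A y ≡ outside
    product-outside prod = subst (λ B → lookup B _ ≡ outside) (proj₂ T∈) (nonProducts-product T prod)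

    outside-product : ∀ {y} → lookup A y ≡ outside → IsProduct T y
    outside-product y∉A = nonProducts-outside T (subst (λ B → lookup B _ ≡ outside) (sym (proj₂ T∈)) y∉A)

    entry : Fin M → Fin n
    entry zero    = z
    entry (suc c) = mul T (elem A (proj₁ (remQuot {r} r c))) (elem A (proj₂ (remQuot {r} r c)))

    entry-outside : ∀ c → lookup A (entry c) ≡ outside
    entry-outside zero    = product-outside z-product
    entry-outside (suc c) = product-outside (_ , _ , refl)

    entry-cell : ∀ x y → entry (cell x y) ≡ mul T x y
    entry-cell x y with find A x in fx | find A y in fy
    ... | just i  | just j  = begin
      entry (suc (combine i j))
        ≡⟨ cong (λ (i , j) → mul T (elem A i) (elem A j)) (remQuot-combine i j) ⟩
      mul T (elem A i) (elem A j)
        ≡⟨ cong₂ (mul T) (find-just A fx) (find-just A fy) ⟩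
      mul T x y
        ∎
    ... | just _  | nothing = sym (∙product (outside-product (find-nothing A fy)) x)
    ... | nothing | _       = sym (product∙ (outside-product (find-nothing A fx)) y)

    code : Fin M → Fin s
    code c = rankᶜ A (entry-outside c)

    encode : Vec (Fin s) M
    encode = tabulate code

    elemᶜ-encode : ∀ c → elemᶜ A (lookup encode c) ≡ entry c
    elemᶜ-encode c = trans (cong (elemᶜ A) (lookup∘tabulate code c)) (elemᶜ-rankᶜ A (entry-outside c))

    decode-encode : ∀ x y → mul (decode encode) x y ≡ mul T x y
    decode-encode x y = trans (mul-decode encode x y) (trans (elemᶜ-encode (cell x y)) (entry-cell x y))

    encode-onto : Onto encode
    encode-onto c with outside-product (elemᶜ-outside A c)
    ... | a , b , ab≡c = cell a b , elem-injective (∁ A)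
      (trans (elemᶜ-encode (cell a b)) (trans (entry-cell a b) ab≡c))

    fibre-s≢1 : s ≢ 1
    fibre-s≢1 s≡1 with nontrivial
    ... | a , b , ab≢z = ab≢z (begin
      mul T a b                                    ≡⟨ sym (elemᶜ-rankᶜ A ab∉A) ⟩
      elemᶜ A (rankᶜ A ab∉A)                       ≡⟨ cong (elemᶜ A) (Fin1-trivial s≡1 _ _) ⟩
      elemᶜ A (rankᶜ A (product-outside z-product)) ≡⟨ elemᶜ-rankᶜ A _ ⟩
      z                                            ∎)
      where
      ab∉A : lookup A (mul T a b) ≡ outside
      ab∉A = product-outside (a , b , refl)

  module Decode (h : Vec (Fin s) M) where
    z : Fin n
    z = elemᶜ A (lookup h zero)

    z∉A : lookup A z ≡ outside
    z∉A = elemᶜ-outside A (lookup h zero)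

    product-outside : ∀ x y → lookup A (mul (decode h) x y) ≡ outside
    product-outside x y = subst (λ v → lookup A v ≡ outside) (sym (mul-decode h x y)) (elemᶜ-outside A _)

    outside∙ : ∀ {x} → lookup A x ≡ outside → ∀ y → mul (decode h) x y ≡ z
    outside∙ x∉A y = trans (mul-decode h _ y) (cong (λ c → elemᶜ A (lookup h c)) (cell-outsideˡ y x∉A))

    ∙outside : ∀ x {y} → lookup A y ≡ outside → mul (decode h) x y ≡ z
    ∙outside x y∉A = trans (mul-decode h x _) (cong (λ c → elemᶜ A (lookup h c)) (cell-outsideʳ x y∉A))

    covers : Onto h → ∀ c → IsProduct (decode h) (elemᶜ A c)
    covers onto c with onto c
    ... | i , hᵢ≡c with cell-surjective z∉A i
    ... | x , y , cell≡i =
      x , y , trans (mul-decode h x y) (cong (elemᶜ A) (trans (cong (lookup h) cell≡i) hᵢ≡c))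

    decode-nil3 : Onto h → s ≢ 1 → IsNil3 (decode h)
    decode-nil3 onto s≢1 = z , (λ x → outside∙ z∉A x , ∙outside x z∉A) , assoc , xyw≡z , nontrivial
      where
      xyw≡z : ∀ x y w → mul (decode h) (mul (decode h) x y) w ≡ z
      xyw≡z x y w = outside∙ (product-outside x y) w

      assoc : ∀ x y w → mul (decode h) (mul (decode h) x y) w ≡ mul (decode h) x (mul (decode h) y w)
      assoc x y w = trans (xyw≡z x y w) (sym (∙outside x (product-outside y w)))

      nontrivial : ∃[ a ] ∃[ b ] mul (decode h) a b ≢ z
      nontrivial with Fin-other s≢1 (lookup h zero)
      ... | c , c≢h₀ with covers onto c
      ... | a , b , ab≡c = a , b , λ ab≡z → c≢h₀ (elem-injective (∁ A) (trans (sym ab≡c) ab≡z))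

    decode-nonProducts : Onto h → nonProducts (decode h) ≡ A
    decode-nonProducts onto = vec-ext pointwise
      where
      pointwise : ∀ y → lookup (nonProducts (decode h)) y ≡ lookup A y
      pointwise y with lookup A y in y∈?
      ... | inside  = nonProducts-nonProduct (decode h) λ (a , b , ab≡y) →
        outside≢inside (trans (sym (product-outside a b)) (trans (cong (lookup A) ab≡y) y∈?))
      ... | outside = nonProducts-product (decode h)
        (subst (IsProduct (decode h)) (elemᶜ-rankᶜ A y∈?) (covers onto (rankᶜ A y∈?)))

  decode-injective : ∀ {h h′} → decode h ≡ decode h′ → h ≡ h′
  decode-injective {h} {h′} eq = vec-ext λ i → pointwise i (cell-surjective (Decode.z∉A h) i)
    where
    pointwise : ∀ i → ∃[ x ] ∃[ y ] cell x y ≡ i → lookup h i ≡ lookup h′ i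
    pointwise i (x , y , refl) = elem-injective (∁ A) (begin
      elemᶜ A (lookup h (cell x y))  ≡⟨ sym (mul-decode h x y) ⟩
      mul (decode h) x y             ≡⟨ cong (λ T → mul T x y) eq ⟩
      mul (decode h′) x y            ≡⟨ mul-decode h′ x y ⟩
      elemᶜ A (lookup h′ (cell x y)) ∎)

  fibre : s ≢ 1 → Card InFibre (surjCount M s)
  fibre s≢1 = Card-transport (surjections M s)
    Encode.encode Encode.encode-onto
    (λ {T} {T′} p q eq → table-ext λ x y → begin
      mul T x y                             ≡⟨ sym (Encode.decode-encode T p x y) ⟩
      mul (decode (Encode.encode T p)) x y   ≡⟨ cong (λ h → mul (decode h) x y) eq ⟩
      mul (decode (Encode.encode T′ q)) x y  ≡⟨ Encode.decode-encode T′ q x y ⟩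
      mul T′ x y                            ∎)
    decode (λ h onto → Decode.decode-nil3 h onto s≢1 , Decode.decode-nonProducts h onto)
    (λ _ _ → decode-injective)

  fibre-empty : s ≡ 1 → Card InFibre 0
  fibre-empty s≡1 = Card-empty λ T p → Encode.fibre-s≢1 T p s≡1

surjCount≡k!*S₂ : ∀ m k → surjCount m k ≡ k ! * S₂ m k
surjCount≡k!*S₂ zero    zero    = refl
surjCount≡k!*S₂ zero    (suc k) = sym (*-zeroʳ (suc k !))
surjCount≡k!*S₂ (suc m) zero    = refl
surjCount≡k!*S₂ (suc m) (suc k) = begin
  suc k * surjCount m (suc k) + suc k * surjCount m k
    ≡⟨ cong₂ (λ u v → suc k * u + suc k * v) (surjCount≡k!*S₂ m (suc k)) (surjCount≡k!*S₂ m k) ⟩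
  suc k * ((suc k * k !) * S₂ m (suc k)) + suc k * (k ! * S₂ m k)
    ≡⟨ factor (suc k) (k !) (S₂ m (suc k)) (S₂ m k) ⟩
  (suc k * k !) * (suc k * S₂ m (suc k) + S₂ m k)
    ∎
  where
  factor : ∀ a f x y → a * ((a * f) * x) + a * (f * y) ≡ (a * f) * (a * x + y)
  factor = solve-∀

-- For s = 1 the fibre is empty: every product would be the zero.
fibreCount : ℕ → ℕ → ℕ
fibreCount r (suc zero) = 0
fibreCount r s          = surjCount (suc (r * r)) s

fibreCount≡s!*S₂ : ∀ r s → s ≢ 1 → fibreCount r s ≡ s ! * S₂ (suc (r * r)) s
fibreCount≡s!*S₂ r zero          _   = refl
fibreCount≡s!*S₂ r (suc zero)    s≢1 = ⊥-elim (s≢1 refl)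
fibreCount≡s!*S₂ r (suc (suc s)) _   = surjCount≡k!*S₂ (suc (r * r)) (suc (suc s))

Card-fibreCount : ∀ {X : Set} {P : X → Set} r s →
  (s ≢ 1 → Card P (surjCount (suc (r * r)) s)) → (s ≡ 1 → Card P 0) → Card P (fibreCount r s)
Card-fibreCount r zero          count _     = count λ ()
Card-fibreCount r (suc zero)    _     empty = empty refl
Card-fibreCount r (suc (suc s)) count _     = count λ ()

nil3Count : ℕ → ℕ
nil3Count n = subsetSum n (λ A → fibreCount ∣ A ∣ ∣ ∁ A ∣)

nil3Card : ∀ n → Card (IsNil3 {n}) (nil3Count n)
nil3Card n = Card-partition n nonProducts _ λ A →
  Card-fibreCount ∣ A ∣ ∣ ∁ A ∣ (Fibre.fibre A) (Fibre.fibre-empty A)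

-- weight n r counts the 3-nilpotent tables on Fin n with exactly r non-products.
weight : ℕ → ℕ → ℕ
weight n r = binomial r (n ∸ r) * fibreCount r (n ∸ r)

diagSum-applyUpTo : ∀ N G → diagSum N G ≡ sum (applyUpTo (λ r → G r (N ∸ r)) (suc N))
diagSum-applyUpTo zero    G = sym (+-identityʳ (G 0 0))
diagSum-applyUpTo (suc N) G = cong (λ u → G 0 (suc N) + u) (diagSum-applyUpTo N (λ r s → G (suc r) s))

sum-applyUpTo-suc : ∀ (f : ℕ → ℕ) k → sum (applyUpTo f (suc k)) ≡ sum (applyUpTo f k) + f k
sum-applyUpTo-suc f k = begin
  sum (applyUpTo f (suc k))        ≡⟨ cong sum (sym (applyUpTo-∷ʳ f k)) ⟩
  sum (applyUpTo f k ++ [ f k ]) ≡⟨ sum-++ (applyUpTo f k) [ f k ] ⟩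
  sum (applyUpTo f k) + (f k + 0)  ≡⟨ cong (λ u → sum (applyUpTo f k) + u) (+-identityʳ (f k)) ⟩
  sum (applyUpTo f k) + f k        ∎

-- The weights with r = 0, n - 1 and n vanish, leaving 1 ≤ r ≤ n - 2.
nil3Count≡ : ∀ m → let n = 3 + m in nil3Count n ≡ sum (applyUpTo (λ i → weight n (suc i)) (n ∸ 2))
nil3Count≡ m = begin
  nil3Count n
    ≡⟨ subsetSum-binomial n fibreCount ⟩
  diagSum n (λ r s → binomial r s * fibreCount r s)
    ≡⟨ diagSum-applyUpTo n (λ r s → binomial r s * fibreCount r s) ⟩
  weight n 0 + sum (applyUpTo f (3 + m))
    ≡⟨ cong₂ _+_ weight₀ (sum-applyUpTo-suc f (2 + m)) ⟩
  sum (applyUpTo f (2 + m)) + f (2 + m)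
    ≡⟨ cong₂ _+_ (sum-applyUpTo-suc f (1 + m)) weightₙ ⟩
  sum (applyUpTo f (1 + m)) + f (1 + m) + 0
    ≡⟨ cong (λ u → sum (applyUpTo f (1 + m)) + u + 0) weightₙ₋₁ ⟩
  sum (applyUpTo f (1 + m)) + 0 + 0
    ≡⟨ trans (+-identityʳ _) (+-identityʳ _) ⟩
  sum (applyUpTo f (1 + m))
    ∎
  where
  n : ℕ
  n = 3 + m
  f : ℕ → ℕ
  f i = weight n (suc i)
  weight₀ : weight n 0 ≡ 0
  weight₀ = trans (+-identityʳ _) (cong₂ _+_ (*-zeroʳ n) (*-zeroʳ n))
  weightₙ₋₁ : f (1 + m) ≡ 0
  weightₙ₋₁ = trans (cong (λ s → binomial (2 + m) s * fibreCount (2 + m) s) (m+n∸n≡m 1 m))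
                    (*-zeroʳ (binomial (2 + m) 1))
  weightₙ : f (2 + m) ≡ 0
  weightₙ = trans (cong (λ s → binomial n s * fibreCount n s) (n∸n≡0 m)) (*-zeroʳ (binomial n 0))

term≡weight/n! : ∀ n r → r ≤ n → n ∸ r ≢ 1 → term n r ≡ _/_ (+ weight n r) (n !) {{n !≢0}}
term≡weight/n! n r r≤n s≢1 = /-cross (S₂ (r * r + 1) s) (weight n r) (r !) (n !) {{r !≢0}} {{n !≢0}} (begin
  S₂ (r * r + 1) s * n !
    ≡⟨ cong₂ (λ u v → S₂ u s * v) (+-comm (r * r) 1) n!≡ ⟩
  S₂ (suc (r * r)) s * (binomial r s * (r ! * s !))
    ≡⟨ shuffle (S₂ (suc (r * r)) s) (binomial r s) (r !) (s !) ⟩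
  binomial r s * (s ! * S₂ (suc (r * r)) s) * r !
    ≡⟨ cong (λ c → binomial r s * c * r !) (sym (fibreCount≡s!*S₂ r s s≢1)) ⟩
  weight n r * r !
    ∎)
  where
  s : ℕ
  s = n ∸ r
  n!≡ : n ! ≡ binomial r s * (r ! * s !)
  n!≡ = trans (cong _! (sym (m+[n∸m]≡n r≤n))) (sym (binomial-factorial r s))
  shuffle : ∀ x b p q → x * (b * (p * q)) ≡ b * (q * x) * p
  shuffle = solve-∀

stirlingSum≡nil3Count/n! : ∀ m → let n = 3 + m in stirlingSum n ≡ _/_ (+ nil3Count n) (n !) {{n !≢0}}
stirlingSum≡nil3Count/n! m = begin
  stirlingSum n
    ≡⟨ sum-/ (suc m) _ (λ i → weight n (suc i)) (n !) {{n !≢0}} term≡ ⟩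
  _/_ (+ sum (applyUpTo (λ i → weight n (suc i)) (suc m))) (n !) {{n !≢0}}
    ≡⟨ cong (λ t → _/_ (+ t) (n !) {{n !≢0}}) (sym (nil3Count≡ m)) ⟩
  _/_ (+ nil3Count n) (n !) {{n !≢0}}
    ∎
  where
  n : ℕ
  n = 3 + m
  term≡ : ∀ i → i < suc m → term n (suc i) ≡ _/_ (+ weight n (suc i)) (n !) {{n !≢0}}
  term≡ i (s≤s i≤m) = term≡weight/n! n (suc i) (s≤s (m≤n⇒m≤1+n (m≤n⇒m≤1+n i≤m)))
    λ s≡1 → 2+≢1 (trans (sym (+-∸-assoc 2 i≤m)) s≡1)
    where
    2+≢1 : ∀ {k} → 2 + k ≢ 1
    2+≢1 ()

corollary5p1 : (n : ℕ) → 3 ≤ n →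
    (L : List (Table n)) → Unique L → (∀ T → IsNil3 T ⇔ T ∈ L) →
    (R : List (Table n)) → All IsNil3 R → AllPairs (λ A B → ¬ Iso A B) R →
    (∀ T → IsNil3 T → Any (Iso T) R) →
    (stirlingSum n ≤ℚ (+ length R) / 1)
    × (stirlingSum n ≡ _/_ (+ length L) (n !) {{n !≢0}})
-- The lower bound only uses that every isomorphism class is represented in R.
corollary5p1 (suc (suc (suc m))) (s≤s (s≤s (s≤s _))) L uniq nil3⇔∈L R _ _ classes = lowerBound , exact
  where
  n : ℕ
  n = 3 + m
  exact : stirlingSum n ≡ _/_ (+ length L) (n !) {{n !≢0}}
  exact = trans (stirlingSum≡nil3Count/n! m)
    (cong (λ t → _/_ (+ t) (n !) {{n !≢0}}) (sym (Card⇒length≡ (nil3Card n) L uniq nil3⇔∈L)))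
  lowerBound : stirlingSum n ≤ℚ (+ length R) / 1
  lowerBound = subst (_≤ℚ (+ length R) / 1) (sym exact)
    (/-≤ (length L) (length R) (n !) {{n !≢0}} (length≤classes*n! L R uniq nil3⇔∈L classes))
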